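{- Let $m\geq 2$. Every strongly $m$-dependent set of points in $\mathbb{P}^b$ (over $\overline{\mathbb{F}}_q$) has at least $2(b+1)$ points.
   Context: Points $p_1,\dotsc,p_t\in\mathbb{P}^b$ (with chosen representatives) are strongly $m$-dependent if they span $\mathbb{P}^b$ and the associated linear forms $\ell_i(x)=\langle x,p_i\rangle$ satisfy a relation $c_1\prod_{j=1}^m\ell_1(x_j)+\dotsb+c_t\prod_{j=1}^m\ell_t(x_j)=0$ (identically in the $m$ vectors of variables $x_1,\dotsc,x_m$, each of length $b+1$) in which all coefficients $c_1,\dotsc,c_t$ are non-zero. -}

module Defs where

open import Level using (Level; _⊔_) renaming (suc to lsuc)
open import Algebra.Bundles using (CommutativeRing)
open import Data.Nat using (ℕ; zero; suc; _^_; _≤_)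
open import Data.Nat.Primality using (Prime)
open import Data.Fin using (Fin; zero; suc; toℕ)
open import Data.Product using (Σ; ∃; _×_)
open import Relation.Nullary using (¬_)
open import Relation.Binary.PropositionalEquality using (_≡_)

module RingOps {c ℓ : Level} (R : CommutativeRing c ℓ) where
  open CommutativeRing R using (Carrier; _≈_; _+_; _*_; 0#; 1#)

  ∑ : ∀ n → (Fin n → Carrier) → Carrier
  ∑ zero    f = 0#
  ∑ (suc n) f = f zero + ∑ n (λ i → f (suc i))

  ∏ : ∀ n → (Fin n → Carrier) → Carrier
  ∏ zero    f = 1#
  ∏ (suc n) f = f zero * ∏ n (λ i → f (suc i))

  pow : Carrier → ℕ → Carrier
  pow x zero    = 1#
  pow x (suc n) = x * pow x n

  natCast : ℕ → Carrier
  natCast zero    = 0#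
  natCast (suc n) = 1# + natCast n

-- A field K isomorphic to an algebraic closure of F_p (= algebraic closure of F_q,
-- q a power of p):  a field of prime characteristic p, algebraically closed, in which
-- every element is algebraic over F_p, i.e. lies in some finite field F_{p^k}
-- (x^(p^k) = x for some k ≥ 1).  These properties characterise \bar{F}_p up to isomorphism.
record IsAlgClosureOfFp {c ℓ : Level} (R : CommutativeRing c ℓ) (p : ℕ) : Set (c ⊔ ℓ) where
  open CommutativeRing R using (Carrier; _≈_; _+_; _*_; 0#; 1#)
  open RingOps R
  field
    p-prime      : Prime p
    nontrivial   : ¬ (1# ≈ 0#)
    inverse      : ∀ x → ¬ (x ≈ 0#) → ∃ λ y → x * y ≈ 1#
    characteristic : natCast p ≈ 0#
    algebraic    : ∀ x → Σ ℕ λ k → (1 ≤ k) × (pow x (p ^ k) ≈ x)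
    alg-closed   : ∀ n (a : Fin (suc n) → Carrier) →
                   ∃ λ x → pow x (suc n) + ∑ (suc n) (λ i → a i * pow x (toℕ i)) ≈ 0#

-- Points of P^b given by representatives p : Fin t → Fin (b+1) → K.
module Projective {c ℓ : Level} (R : CommutativeRing c ℓ) where
  open CommutativeRing R using (Carrier; _≈_; _+_; _*_; 0#; 1#)
  open RingOps R

  Vect : ℕ → Set c
  Vect b = Fin (suc b) → Carrier

  ⟨_,_⟩ : ∀ {b} → Vect b → Vect b → Carrier
  ⟨_,_⟩ {b} x y = ∑ (suc b) (λ k → x k * y k)

  NonZeroVec : ∀ {b} → Vect b → Set ℓ
  NonZeroVec v = ¬ (∀ k → v k ≈ 0#)

  Proportional : ∀ {b} → Vect b → Vect b → Set (c ⊔ ℓ)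
  Proportional u v = ∃ λ μ → ∀ k → u k ≈ μ * v k

  IsPointSet : ∀ {b t} → (Fin t → Vect b) → Set (c ⊔ ℓ)
  IsPointSet {b} {t} P = (∀ i → NonZeroVec (P i)) × (∀ i j → ¬ (i ≡ j) → ¬ Proportional (P i) (P j))

  Spans : ∀ {b t} → (Fin t → Vect b) → Set (c ⊔ ℓ)
  Spans {b} {t} P = ∀ (v : Vect b) → ∃ λ (a : Fin t → Carrier) → ∀ k → v k ≈ ∑ t (λ i → a i * P i k)

  StronglyDependent : ∀ {b t} → ℕ → (Fin t → Vect b) → Set (c ⊔ ℓ)
  StronglyDependent {b} {t} m P =
    Spans P ×
    (∃ λ (cs : Fin t → Carrier) → (∀ i → ¬ (cs i ≈ 0#)) ×
       (∀ (x : Fin m → Vect b) → ∑ t (λ i → cs i * ∏ m (λ j → ⟨ x j , P i ⟩)) ≈ 0#))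

-- Suppose t < 2(b+1). A maximal independent subset B of the points spans what the points
-- span, hence has at least b+1 elements, so at most b points lie outside B and some y ≠ 0
-- is orthogonal to all of them. Putting x₁ = δₖ and x₂ = … = xₘ = y in the relation gives
-- the linear relation Σᵢ cᵢ ⟨y,pᵢ⟩^(m-1) pᵢ = 0, which is supported on B; independence and
-- cᵢ ≠ 0 force ⟨y,pᵢ⟩ = 0 for all i, so y is orthogonal to a spanning set, i.e. y = 0. Equality in the field is undecidable, so every case distinction is made under
-- double negation; this suffices because the conclusion is decidable.
module Submission where

open import Defs
open import Algebra.Bundles using (CommutativeRing)
open import Data.Nat using (ℕ; suc; _*_; _≤_)
open import Data.Fin using (Fin)

open import Level using (Level; _⊔_)
open import Function using (_∘_; flip; case_of_)
open import Data.Nat using (zero; _<_; _∸_; _≤?_; s≤s; s≤s⁻¹)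
import Data.Nat as ℕ
open import Data.Nat.Properties
  using (≤-trans; ≤-reflexive; <-≤-trans; ≮⇒≥; ≰⇒>; ∸-monoʳ-≤; m≤n+o⇒m∸n≤o)
import Data.Nat.Properties as ℕₚ
open import Data.Fin using (zero; suc; _≟_)
open import Data.Fin.Properties using (any?; ∀-cons)
open import Data.Fin.Subset using (Subset; _∈_; _∉_; ∣_∣; ∁; ⊤; _-_; inside; outside)
open import Data.Fin.Subset.Properties
  using (_∈?_; ∈⊤; drop-there; x∉p⇒x∈∁p; ∣∁p∣≡n∸∣p∣; x∈p⇒∣p-x∣<∣p∣; x∈p∧x≢y⇒x∈p-y)
open import Data.Vec using ([]; _∷_; here; there)
import Data.Vec.Functional as Vector
open import Data.Product using (∃; _×_; _,_; proj₁; proj₂)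
open import Data.Empty using (⊥)
open import Relation.Nullary using (¬_; yes; no; ¬?; _×-dec_)
open import Relation.Nullary.Negation using (contradiction; negated-stable; ¬¬-map)
open import Relation.Nullary.Decidable using (¬¬-excluded-middle; decidable-stable)
open import Relation.Binary.PropositionalEquality as ≡ using (_≡_; _≢_)

private
  variable
    ℓ₁ ℓ₂ : Level
    A : Set ℓ₁
    B : Set ℓ₂

-- The library's ¬¬-Monad lives in a single universe; this bind mixes levels.
infixl 1 _>>=_
_>>=_ : ¬ ¬ A → (A → ¬ ¬ B) → ¬ ¬ B
¬¬a >>= f = negated-stable (¬¬-map f ¬¬a)

return : A → ¬ ¬ A
return = contradiction

¬¬-pull-Fin : ∀ n {P : Fin n → Set ℓ₁} → (∀ i → ¬ ¬ P i) → ¬ ¬ (∀ i → P i)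
¬¬-pull-Fin zero    _   = return λ ()
¬¬-pull-Fin (suc n) ¬¬P = do
  p₀ ← ¬¬P zero
  ps ← ¬¬-pull-Fin n (¬¬P ∘ suc)
  return (∀-cons p₀ ps)

2[1+n]≡1+[1+n+n] : ∀ n → 2 * suc n ≡ suc (suc n ℕ.+ n)
2[1+n]≡1+[1+n+n] n = ≡.trans (≡.cong (suc n ℕ.+_) (ℕₚ.+-identityʳ (suc n))) (ℕₚ.+-suc (suc n) n)

n<2[1+b]∧1+b≤k⇒n∸k≤b : ∀ {n k b} → n < 2 * suc b → suc b ≤ k → n ∸ k ≤ b
n<2[1+b]∧1+b≤k⇒n∸k≤b {n} {k} {b} n<2[1+b] 1+b≤k =
  ≤-trans (∸-monoʳ-≤ n 1+b≤k)
          (m≤n+o⇒m∸n≤o n (suc b) (s≤s⁻¹ (≤-trans n<2[1+b] (≤-reflexive (2[1+n]≡1+[1+n+n] b)))))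

module SumProperties {c ℓ} (R : CommutativeRing c ℓ) where
  open CommutativeRing R hiding (zero) renaming (_*_ to _·_)
  open RingOps R
  open import Algebra.Properties.Semiring.Sum semiring as Sum using (sum)
  open import Relation.Binary.Reasoning.Setoid setoid

  ∑≡sum : ∀ n (f : Fin n → Carrier) → ∑ n f ≡ sum f
  ∑≡sum zero    f = ≡.refl
  ∑≡sum (suc n) f = ≡.cong (f zero +_) (∑≡sum n (f ∘ suc))

  ∑-cong : ∀ n {f g : Fin n → Carrier} → (∀ i → f i ≈ g i) → ∑ n f ≈ ∑ n g
  ∑-cong n {f} {g} f≈g rewrite ∑≡sum n f | ∑≡sum n g = Sum.sum-cong-≋ f≈g

  ∑-zero : ∀ n {f : Fin n → Carrier} → (∀ i → f i ≈ 0#) → ∑ n f ≈ 0#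
  ∑-zero n {f} f≈0 rewrite ∑≡sum n f = trans (Sum.sum-cong-≋ f≈0) (Sum.sum-replicate-zero n)

  ∑-distrib-+ : ∀ n (f g : Fin n → Carrier) → ∑ n (λ i → f i + g i) ≈ ∑ n f + ∑ n g
  ∑-distrib-+ n f g rewrite ∑≡sum n (λ i → f i + g i) | ∑≡sum n f | ∑≡sum n g =
    Sum.∑-distrib-+ f g

  *-distribˡ-∑ : ∀ n x (f : Fin n → Carrier) → x · ∑ n f ≈ ∑ n (λ i → x · f i)
  *-distribˡ-∑ n x f rewrite ∑≡sum n f | ∑≡sum n (λ i → x · f i) = Sum.*-distribˡ-sum x f

  ∑-comm : ∀ m n (f : Fin m → Fin n → Carrier) →
           ∑ m (λ i → ∑ n (f i)) ≈ ∑ n (λ j → ∑ m (λ i → f i j))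
  ∑-comm m n f = begin
    ∑ m (λ i → ∑ n (f i))          ≡⟨ ∑∑≡sumsum m n f ⟩
    sum (λ i → sum (f i))          ≈⟨ Sum.∑-comm f ⟩
    sum (λ j → sum (λ i → f i j))  ≡⟨ ∑∑≡sumsum n m (flip f) ⟨
    ∑ n (λ j → ∑ m (λ i → f i j))  ∎
    where
    ∑∑≡sumsum : ∀ m n (f : Fin m → Fin n → Carrier) → ∑ m (λ i → ∑ n (f i)) ≡ sum (λ i → sum (f i))
    ∑∑≡sumsum m n f = ≡.trans (∑≡sum m _) (Sum.sum-cong-≗ (λ i → ∑≡sum n (f i)))

  δ : ∀ {n} → Fin n → Fin n → Carrier
  δ zero    zero    = 1#
  δ zero    (suc _) = 0#
  δ (suc _) zero    = 0#
  δ (suc i) (suc j) = δ i j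

  δ-≢ : ∀ {n} {i j : Fin n} → i ≢ j → δ i j ≈ 0#
  δ-≢ {i = zero}  {zero}  i≢j = contradiction ≡.refl i≢j
  δ-≢ {i = zero}  {suc _} _   = refl
  δ-≢ {i = suc _} {zero}  _   = refl
  δ-≢ {i = suc _} {suc _} i≢j = δ-≢ (i≢j ∘ ≡.cong suc)

  ∑-*δ : ∀ n (f : Fin n → Carrier) i → ∑ n (λ j → f j · δ i j) ≈ f i
  ∑-*δ (suc n) f zero = begin
    f zero · 1# + ∑ n (λ j → f (suc j) · 0#)  ≈⟨ +-cong (*-identityʳ _) (∑-zero n (λ _ → zeroʳ _)) ⟩
    f zero + 0#                               ≈⟨ +-identityʳ _ ⟩
    f zero                                    ∎
  ∑-*δ (suc n) f (suc i) = begin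
    f zero · 0# + ∑ n (λ j → f (suc j) · δ i j)  ≈⟨ +-cong (zeroʳ _) (∑-*δ n (f ∘ suc) i) ⟩
    0# + f (suc i)                               ≈⟨ +-identityˡ _ ⟩
    f (suc i)                                    ∎

  ∑-δ* : ∀ n (f : Fin n → Carrier) i → ∑ n (λ j → δ i j · f j) ≈ f i
  ∑-δ* n f i = trans (∑-cong n (λ j → *-comm (δ i j) (f j))) (∑-*δ n f i)

module PairingProperties {c ℓ} (R : CommutativeRing c ℓ) where
  open CommutativeRing R hiding (zero) renaming (_*_ to _·_)
  open RingOps R
  open Projective R
  open SumProperties R
  open import Algebra.Properties.CommutativeSemigroup *-commutativeSemigroup using (x∙yz≈y∙xz)
  open import Relation.Binary.Reasoning.Setoid setoid

  lincomb : ∀ {b t} → (Fin t → Carrier) → (Fin t → Vect b) → Vect b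
  lincomb {t = t} a Q k = ∑ t (λ i → a i · Q i k)

  SupportedOn : ∀ {t} → Subset t → (Fin t → Carrier) → Set ℓ
  SupportedOn B a = ∀ i → i ∉ B → a i ≈ 0#

  InSpan : ∀ {b t} → (Fin t → Vect b) → Subset t → Vect b → Set (c ⊔ ℓ)
  InSpan Q B v = ∃ λ a → SupportedOn B a × (∀ k → v k ≈ lincomb a Q k)

  -- Only the double negation of aᵢ ≈ 0 is available: building a basis has to decide
  -- whether a coefficient vanishes.
  Independent : ∀ {b t} → (Fin t → Vect b) → Subset t → Set (c ⊔ ℓ)
  Independent Q B = ∀ a → SupportedOn B a → (∀ k → lincomb a Q k ≈ 0#) → ∀ i → ¬ ¬ a i ≈ 0#

  Orthogonal : ∀ {b t} → Vect b → (Fin t → Vect b) → Subset t → Set ℓ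
  Orthogonal y Q S = ∀ i → i ∈ S → ⟨ y , Q i ⟩ ≈ 0#

  lincomb-tail : ∀ {b t} (a : Fin (suc t) → Carrier) (Q : Fin (suc t) → Vect b) → a zero ≈ 0# →
                 ∀ k → lincomb a Q k ≈ lincomb (a ∘ suc) (Q ∘ suc) k
  lincomb-tail a Q a₀≈0 k = trans (+-congʳ (trans (*-congʳ a₀≈0) (zeroˡ _))) (+-identityˡ _)

  *-distribˡ-lincomb : ∀ {b t} x (a : Fin t → Carrier) (Q : Fin t → Vect b) k →
                       x · lincomb a Q k ≈ lincomb (λ i → x · a i) Q k
  *-distribˡ-lincomb {t = t} x a Q k =
    trans (*-distribˡ-∑ t x _) (∑-cong t (λ i → sym (*-assoc x (a i) (Q i k))))

  ⟨,⟩-congʳ : ∀ {b} (y : Vect b) {u v : Vect b} → (∀ k → u k ≈ v k) → ⟨ y , u ⟩ ≈ ⟨ y , v ⟩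
  ⟨,⟩-congʳ {b} y u≈v = ∑-cong (suc b) (λ k → *-congˡ {y k} (u≈v k))

  ⟨,δ⟩ : ∀ {b} (y : Vect b) k → ⟨ y , δ k ⟩ ≈ y k
  ⟨,δ⟩ y = ∑-*δ _ y

  ⟨δ,⟩ : ∀ {b} k (v : Vect b) → ⟨ δ k , v ⟩ ≈ v k
  ⟨δ,⟩ k v = ∑-δ* _ v k

  ⟨,+*⟩ : ∀ {b} (y u v : Vect b) α → ⟨ y , (λ k → u k + α · v k) ⟩ ≈ ⟨ y , u ⟩ + α · ⟨ y , v ⟩
  ⟨,+*⟩ {b} y u v α = begin
    ∑ (suc b) (λ k → y k · (u k + α · v k))
      ≈⟨ ∑-cong (suc b) (λ k → distribˡ (y k) (u k) (α · v k)) ⟩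
    ∑ (suc b) (λ k → y k · u k + y k · (α · v k))
      ≈⟨ ∑-distrib-+ (suc b) (λ k → y k · u k) (λ k → y k · (α · v k)) ⟩
    ⟨ y , u ⟩ + ∑ (suc b) (λ k → y k · (α · v k))
      ≈⟨ +-congˡ (∑-cong (suc b) (λ k → x∙yz≈y∙xz (y k) α (v k))) ⟩
    ⟨ y , u ⟩ + ∑ (suc b) (λ k → α · (y k · v k))
      ≈⟨ +-congˡ (*-distribˡ-∑ (suc b) α (λ k → y k · v k)) ⟨
    ⟨ y , u ⟩ + α · ⟨ y , v ⟩
      ∎

  ⟨,lincomb⟩ : ∀ {b t} (y : Vect b) (a : Fin t → Carrier) (Q : Fin t → Vect b) →
               ⟨ y , lincomb a Q ⟩ ≈ ∑ t (λ i → a i · ⟨ y , Q i ⟩)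
  ⟨,lincomb⟩ {b} {t} y a Q = begin
    ∑ (suc b) (λ k → y k · ∑ t (λ i → a i · Q i k))
      ≈⟨ ∑-cong (suc b) (λ k → *-distribˡ-∑ t (y k) (λ i → a i · Q i k)) ⟩
    ∑ (suc b) (λ k → ∑ t (λ i → y k · (a i · Q i k)))
      ≈⟨ ∑-comm (suc b) t (λ k i → y k · (a i · Q i k)) ⟩
    ∑ t (λ i → ∑ (suc b) (λ k → y k · (a i · Q i k)))
      ≈⟨ ∑-cong t (λ i → ∑-cong (suc b) (λ k → x∙yz≈y∙xz (y k) (a i) (Q i k))) ⟩
    ∑ t (λ i → ∑ (suc b) (λ k → a i · (y k · Q i k)))
      ≈⟨ ∑-cong t (λ i → *-distribˡ-∑ (suc b) (a i) (λ k → y k · Q i k)) ⟨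
    ∑ t (λ i → a i · ⟨ y , Q i ⟩)
      ∎

  ∈⇒InSpan : ∀ {b t} (Q : Fin t → Vect b) {B i} → i ∈ B → InSpan Q B (Q i)
  ∈⇒InSpan {t = t} Q {i = i} i∈B =
    δ i , (λ j j∉B → δ-≢ {i = i} {j} λ { ≡.refl → j∉B i∈B }) , (λ k → sym (∑-δ* t (λ j → Q j k) i))

  InSpan-∷ : ∀ {b t} (Q : Fin (suc t) → Vect b) s {B v} → InSpan (Q ∘ suc) B v → InSpan Q (s ∷ B) v
  InSpan-∷ Q s (a , a-supp , v≈) =
    (0# Vector.∷ a) , ∀-cons (λ _ → refl) (λ i i∉B → a-supp i (i∉B ∘ there)) ,
    (λ k → trans (v≈ k) (sym (lincomb-tail (0# Vector.∷ a) Q refl k)))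

  Spans⇒InSpan-⊤ : ∀ {b t} {P : Fin t → Vect b} → Spans P → ∀ v → InSpan P ⊤ v
  Spans⇒InSpan-⊤ spans v with spans v
  ... | a , v≈ = a , (λ _ i∉⊤ → contradiction ∈⊤ i∉⊤) , v≈

  orthogonal-InSpan : ∀ {b t} (y : Vect b) {Q : Fin t → Vect b} {B v} →
                      Orthogonal y Q B → InSpan Q B v → ⟨ y , v ⟩ ≈ 0#
  orthogonal-InSpan {t = t} y {Q} {B} {v} y⊥B (a , a-supp , v≈) = begin
    ⟨ y , v ⟩                      ≈⟨ ⟨,⟩-congʳ y v≈ ⟩
    ⟨ y , lincomb a Q ⟩            ≈⟨ ⟨,lincomb⟩ y a Q ⟩
    ∑ t (λ i → a i · ⟨ y , Q i ⟩)  ≈⟨ ∑-zero t term≈0 ⟩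
    0#                             ∎
    where
    term≈0 : ∀ i → a i · ⟨ y , Q i ⟩ ≈ 0#
    term≈0 i with i ∈? B
    ... | yes i∈B = trans (*-congˡ (y⊥B i i∈B)) (zeroʳ _)
    ... | no  i∉B = trans (*-congʳ (a-supp i i∉B)) (zeroˡ _)

  spanning-orthogonal⇒≈0 : ∀ {b t} {P : Fin t → Vect b} → Spans P →
                           ∀ y → (∀ i → ⟨ y , P i ⟩ ≈ 0#) → ∀ k → y k ≈ 0#
  spanning-orthogonal⇒≈0 spans y y⊥P k = begin
    y k          ≈⟨ ⟨,δ⟩ y k ⟨
    ⟨ y , δ k ⟩  ≈⟨ orthogonal-InSpan y (λ i _ → y⊥P i) (Spans⇒InSpan-⊤ spans (δ k)) ⟩
    0#           ∎

  relation⇒lincomb≈0 : ∀ {m b t} (P : Fin t → Vect b) (cs : Fin t → Carrier) →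
    (∀ (x : Fin (suc m) → Vect b) → ∑ t (λ i → cs i · ∏ (suc m) (λ j → ⟨ x j , P i ⟩)) ≈ 0#) →
    ∀ y k → lincomb (λ i → cs i · ∏ m (λ _ → ⟨ y , P i ⟩)) P k ≈ 0#
  relation⇒lincomb≈0 {m} {t = t} P cs relation y k =
    trans (∑-cong t term≈) (relation (δ k Vector.∷ λ _ → y))
    where
    term≈ : ∀ i → (cs i · ∏ m (λ _ → ⟨ y , P i ⟩)) · P i k ≈
                  cs i · (⟨ δ k , P i ⟩ · ∏ m (λ _ → ⟨ y , P i ⟩))
    term≈ i = begin
      (cs i · Π) · P i k      ≈⟨ *-assoc (cs i) Π (P i k) ⟩
      cs i · (Π · P i k)      ≈⟨ *-congˡ (*-comm Π (P i k)) ⟩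
      cs i · (P i k · Π)      ≈⟨ *-congˡ (*-congʳ (⟨δ,⟩ k (P i))) ⟨
      cs i · (⟨ δ k , P i ⟩ · Π) ∎
      where Π = ∏ m (λ _ → ⟨ y , P i ⟩)

record IsField {c ℓ} (K : CommutativeRing c ℓ) : Set (c ⊔ ℓ) where
  open CommutativeRing K renaming (_*_ to _·_)
  field
    1≉0     : ¬ 1# ≈ 0#
    inverse : ∀ x → ¬ x ≈ 0# → ∃ λ y → x · y ≈ 1#

module FieldProperties {c ℓ} {K : CommutativeRing c ℓ} (isField : IsField K) where
  open CommutativeRing K hiding (zero; _-_) renaming (_*_ to _·_)
  open IsField isField
  open RingOps K
  open Projective K
  open SumProperties K
  open PairingProperties K
  open import Algebra.Properties.Ring ring using (-‿distribˡ-*; -‿distribʳ-*; +-inverseˡ-unique)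
  open import Algebra.Properties.CommutativeSemigroup *-commutativeSemigroup using (xy∙z≈zx∙y)
  open import Relation.Binary.Reasoning.Setoid setoid

  x≉0∧xy≈0⇒y≈0 : ∀ {x y} → ¬ x ≈ 0# → x · y ≈ 0# → y ≈ 0#
  x≉0∧xy≈0⇒y≈0 {x} {y} x≉0 xy≈0 = begin
    y              ≈⟨ *-identityˡ y ⟨
    1# · y         ≈⟨ *-congʳ (trans (*-comm x⁻¹ x) xx⁻¹≈1) ⟨
    (x⁻¹ · x) · y  ≈⟨ *-assoc x⁻¹ x y ⟩
    x⁻¹ · (x · y)  ≈⟨ *-congˡ xy≈0 ⟩
    x⁻¹ · 0#       ≈⟨ zeroʳ x⁻¹ ⟩
    0#             ∎
    where
    x⁻¹ = proj₁ (inverse x x≉0)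
    xx⁻¹≈1 = proj₂ (inverse x x≉0)

  ∏-≉0 : ∀ n {f : Fin n → Carrier} → (∀ i → ¬ f i ≈ 0#) → ¬ ∏ n f ≈ 0#
  ∏-≉0 zero    _   = 1≉0
  ∏-≉0 (suc n) f≉0 = ∏-≉0 n (f≉0 ∘ suc) ∘ x≉0∧xy≈0⇒y≈0 (f≉0 zero)

  module Elimination {b k} (Q : Fin k → Vect (suc b)) (r : Fin k) (Qr₀≉0 : ¬ Q r zero ≈ 0#) where
    q⁻¹ : Carrier
    q⁻¹ = proj₁ (inverse (Q r zero) Qr₀≉0)

    reduced : Fin k → Vect b
    reduced i j = Q i (suc j) + - (Q i zero · q⁻¹) · Q r (suc j)

    lift : Vect b → Vect (suc b)
    lift y′ = - (q⁻¹ · ⟨ y′ , Vector.tail (Q r) ⟩) Vector.∷ y′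

    -[q⁻¹x]a≈-[aq⁻¹]x : ∀ x a → - (q⁻¹ · x) · a ≈ - (a · q⁻¹) · x
    -[q⁻¹x]a≈-[aq⁻¹]x x a = begin
      - (q⁻¹ · x) · a   ≈⟨ -‿distribˡ-* _ a ⟨
      - ((q⁻¹ · x) · a) ≈⟨ -‿cong (xy∙z≈zx∙y q⁻¹ x a) ⟩
      - ((a · q⁻¹) · x) ≈⟨ -‿distribˡ-* _ x ⟩
      - (a · q⁻¹) · x   ∎

    ⟨lift,⟩≈⟨,reduced⟩ : ∀ y′ i → ⟨ lift y′ , Q i ⟩ ≈ ⟨ y′ , reduced i ⟩
    ⟨lift,⟩≈⟨,reduced⟩ y′ i = begin
      - (q⁻¹ · L) · Q i zero + ⟨ y′ , Vector.tail (Q i) ⟩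
        ≈⟨ +-comm _ _ ⟩
      ⟨ y′ , Vector.tail (Q i) ⟩ + - (q⁻¹ · L) · Q i zero
        ≈⟨ +-congˡ (-[q⁻¹x]a≈-[aq⁻¹]x L (Q i zero)) ⟩
      ⟨ y′ , Vector.tail (Q i) ⟩ + - (Q i zero · q⁻¹) · L
        ≈⟨ ⟨,+*⟩ y′ (Vector.tail (Q i)) (Vector.tail (Q r)) (- (Q i zero · q⁻¹)) ⟨
      ⟨ y′ , reduced i ⟩
        ∎
      where L = ⟨ y′ , Vector.tail (Q r) ⟩

    ⟨lift,pivot⟩≈0 : ∀ y′ → ⟨ lift y′ , Q r ⟩ ≈ 0#
    ⟨lift,pivot⟩≈0 y′ = begin
      - (q⁻¹ · L) · Q r zero + L  ≈⟨ +-congʳ (-[q⁻¹x]a≈-[aq⁻¹]x L (Q r zero)) ⟩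
      - (Q r zero · q⁻¹) · L + L  ≈⟨ +-congʳ (*-congʳ (-‿cong (proj₂ (inverse (Q r zero) Qr₀≉0)))) ⟩
      - 1# · L + L                ≈⟨ +-congʳ (-‿distribˡ-* 1# L) ⟨
      - (1# · L) + L              ≈⟨ +-congʳ (-‿cong (*-identityˡ L)) ⟩
      - L + L                     ≈⟨ -‿inverseˡ L ⟩
      0#                          ∎
      where L = ⟨ y′ , Vector.tail (Q r) ⟩

    lift-solution : ∀ {S} → r ∈ S → (∃ λ y′ → NonZeroVec y′ × Orthogonal y′ reduced (S - r)) →
                    ∃ λ y → NonZeroVec y × Orthogonal y Q S
    lift-solution r∈S (y′ , y′≉0 , y′⊥) = lift y′ , (λ lift≈0 → y′≉0 (lift≈0 ∘ suc)) , lift⊥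
      where
      lift⊥ : Orthogonal (lift y′) Q _
      lift⊥ i i∈S with i ≟ r
      ... | yes ≡.refl = ⟨lift,pivot⟩≈0 y′
      ... | no  i≢r    = trans (⟨lift,⟩≈⟨,reduced⟩ y′ i) (y′⊥ i (x∈p∧x≢y⇒x∈p-y i∈S i≢r))

  nonzero-orthogonal : ∀ b {k} (Q : Fin k → Vect b) (S : Subset k) → ∣ S ∣ ≤ b →
                       ¬ ¬ (∃ λ y → NonZeroVec y × Orthogonal y Q S)
  nonzero-orthogonal b {k} Q S ∣S∣≤b = do
    Q₀≟0 ← ¬¬-pull-Fin k (λ i → ¬¬-excluded-middle {A = Q i zero ≈ 0#})
    case any? (λ r → r ∈? S ×-dec ¬? (Q₀≟0 r)) of λ where
      (yes (r , r∈S , Qr₀≉0)) → eliminate b Q r∈S Qr₀≉0 (<-≤-trans (x∈p⇒∣p-x∣<∣p∣ r∈S) ∣S∣≤b)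
      (no ∄pivot) → return (δ zero , (λ δ≈0 → 1≉0 (δ≈0 zero)) , λ i i∈S →
        trans (⟨δ,⟩ zero (Q i)) (decidable-stable (Q₀≟0 i) (λ Qi₀≉0 → ∄pivot (i , i∈S , Qi₀≉0))))
    where
    eliminate : ∀ b (Q : Fin k → Vect b) {r} → r ∈ S → ¬ Q r zero ≈ 0# → ∣ S - r ∣ < b →
                ¬ ¬ (∃ λ y → NonZeroVec y × Orthogonal y Q S)
    eliminate (suc b) Q {r} r∈S Qr₀≉0 ∣S-r∣<1+b =
      ¬¬-map (lift-solution r∈S) (nonzero-orthogonal b reduced (S - r) (s≤s⁻¹ ∣S-r∣<1+b))
      where open Elimination Q r Qr₀≉0

  Independent-∷ : ∀ {b t} (Q : Fin (suc t) → Vect b) {B : Subset t} s → Independent (Q ∘ suc) B →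
                  (∀ a → SupportedOn (s ∷ B) a → (∀ k → lincomb a Q k ≈ 0#) → ¬ ¬ a zero ≈ 0#) →
                  Independent Q (s ∷ B)
  Independent-∷ Q s independent a₀-forced a a-supp a≈0 zero = a₀-forced a a-supp a≈0
  Independent-∷ Q s independent a₀-forced a a-supp a≈0 (suc i) = do
    a₀≈0 ← a₀-forced a a-supp a≈0
    independent (a ∘ suc) (λ j j∉B → a-supp (suc j) (j∉B ∘ drop-there))
                (λ k → trans (sym (lincomb-tail a Q a₀≈0 k)) (a≈0 k)) i

  dependence⇒InSpan : ∀ {b t} (Q : Fin (suc t) → Vect b) {B : Subset t} a → ¬ a zero ≈ 0# →
                      SupportedOn B (a ∘ suc) → (∀ k → lincomb a Q k ≈ 0#) → InSpan (Q ∘ suc) B (Q zero)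
  dependence⇒InSpan Q a a₀≉0 a-supp a≈0 =
    (λ j → - a₀⁻¹ · a (suc j)) , (λ j j∉B → trans (*-congˡ (a-supp j j∉B)) (zeroʳ _)) , Q₀≈
    where
    a₀⁻¹ = proj₁ (inverse (a zero) a₀≉0)
    a₀a₀⁻¹≈1 = proj₂ (inverse (a zero) a₀≉0)
    Q₀≈ : ∀ k → Q zero k ≈ lincomb (λ j → - a₀⁻¹ · a (suc j)) (Q ∘ suc) k
    Q₀≈ k = begin
      Q zero k                      ≈⟨ *-identityˡ _ ⟨
      1# · Q zero k                 ≈⟨ *-congʳ (trans (*-comm a₀⁻¹ (a zero)) a₀a₀⁻¹≈1) ⟨
      (a₀⁻¹ · a zero) · Q zero k    ≈⟨ *-assoc _ _ _ ⟩
      a₀⁻¹ · (a zero · Q zero k)    ≈⟨ *-congˡ (+-inverseˡ-unique _ _ (a≈0 k)) ⟩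
      a₀⁻¹ · - T                    ≈⟨ -‿distribʳ-* a₀⁻¹ T ⟨
      - (a₀⁻¹ · T)                  ≈⟨ -‿distribˡ-* a₀⁻¹ T ⟩
      - a₀⁻¹ · T                    ≈⟨ *-distribˡ-lincomb (- a₀⁻¹) (a ∘ suc) (Q ∘ suc) k ⟩
      lincomb (λ j → - a₀⁻¹ · a (suc j)) (Q ∘ suc) k ∎
      where T = lincomb (a ∘ suc) (Q ∘ suc) k

  basis : ∀ {b} t (Q : Fin t → Vect b) → ¬ ¬ (∃ λ B → Independent Q B × (∀ i → InSpan Q B (Q i)))
  basis zero    Q = return ([] , (λ _ _ _ ()) , λ ())
  basis (suc t) Q = do
    (B , independent , spanned) ← basis t (Q ∘ suc)
    yes Q₀∈span ← ¬¬-excluded-middle {A = InSpan (Q ∘ suc) B (Q zero)}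
      where no Q₀∉span → return
              ( inside ∷ B
              , Independent-∷ Q inside independent (λ a a-supp a≈0 a₀≉0 →
                  Q₀∉span (dependence⇒InSpan Q a a₀≉0 (λ j j∉B → a-supp (suc j) (j∉B ∘ drop-there)) a≈0))
              , ∀-cons (∈⇒InSpan Q here) (InSpan-∷ Q inside ∘ spanned))
    return ( outside ∷ B
           , Independent-∷ Q outside independent (λ a a-supp _ → return (a-supp zero λ ()))
           , ∀-cons (InSpan-∷ Q outside Q₀∈span) (InSpan-∷ Q outside ∘ spanned))

  spanning⇒1+b≤∣B∣ : ∀ {b t} {P : Fin t → Vect b} {B : Subset t} → Spans P →
                     (∀ i → InSpan P B (P i)) → suc b ≤ ∣ B ∣
  spanning⇒1+b≤∣B∣ {b} {P = P} {B} spans spanned = decidable-stable (suc b ≤? ∣ B ∣) λ 1+b≰∣B∣ →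
    nonzero-orthogonal b P B (s≤s⁻¹ (≰⇒> 1+b≰∣B∣)) λ (y , y≉0 , y⊥B) →
      y≉0 (spanning-orthogonal⇒≈0 spans y (λ i → orthogonal-InSpan y y⊥B (spanned i)))

  orthogonal-outside-basis : ∀ {m b t} (P : Fin t → Vect b) {cs : Fin t → Carrier} {B} y →
    (∀ i → ¬ cs i ≈ 0#) →
    (∀ (x : Fin (suc (suc m)) → Vect b) →
       ∑ t (λ i → cs i · ∏ (suc (suc m)) (λ j → ⟨ x j , P i ⟩)) ≈ 0#) →
    Independent P B → Orthogonal y P (∁ B) → ∀ i → ¬ ¬ ⟨ y , P i ⟩ ≈ 0#
  orthogonal-outside-basis {m} P {cs} {B} y cs≉0 relation independent y⊥∁B i ⟨y,Pᵢ⟩≉0 =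
    independent a a-supp (relation⇒lincomb≈0 P cs relation y) i λ aᵢ≈0 →
      ∏-≉0 (suc m) (λ _ → ⟨y,Pᵢ⟩≉0) (x≉0∧xy≈0⇒y≈0 (cs≉0 i) aᵢ≈0)
    where
    a : Fin _ → Carrier
    a i = cs i · ∏ (suc m) (λ _ → ⟨ y , P i ⟩)
    a-supp : SupportedOn B a
    a-supp i i∉B = trans (*-congˡ (trans (*-congʳ (y⊥∁B i (x∉p⇒x∈∁p i∉B))) (zeroˡ _))) (zeroʳ _)

  2[1+b]≤t : ∀ {m b t} (P : Fin t → Vect b) → 2 ≤ m → StronglyDependent m P → 2 * suc b ≤ t
  2[1+b]≤t {suc (suc m)} {b} {t} P (s≤s (s≤s _)) (spans , cs , cs≉0 , relation) =
    ≮⇒≥ λ t<2[1+b] → refute t<2[1+b] λ ()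
    where
    refute : t < 2 * suc b → ¬ ¬ ⊥
    refute t<2[1+b] = do
      (B , independent , spanned) ← basis t P
      let ∣∁B∣≤b = ≤-trans (≤-reflexive (∣∁p∣≡n∸∣p∣ B))
                           (n<2[1+b]∧1+b≤k⇒n∸k≤b t<2[1+b] (spanning⇒1+b≤∣B∣ spans spanned))
      (y , y≉0 , y⊥∁B) ← nonzero-orthogonal b P (∁ B) ∣∁B∣≤b
      y⊥P ← ¬¬-pull-Fin t (orthogonal-outside-basis P y cs≉0 relation independent y⊥∁B)
      return (y≉0 (spanning-orthogonal⇒≈0 spans y y⊥P))

lemma17 : ∀ {c ℓ} (K : CommutativeRing c ℓ) (p : ℕ) → IsAlgClosureOfFp K p →
    ∀ (m b t : ℕ) → 2 ≤ m →
    (P : Fin t → Projective.Vect K b) →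
    Projective.IsPointSet K P → Projective.StronglyDependent K m P →
    2 * suc b ≤ t
lemma17 K p closure m b t 2≤m P _ dependent = FieldProperties.2[1+b]≤t isField P 2≤m dependent
  where
  open IsAlgClosureOfFp closure using (nontrivial; inverse)
  isField : IsField K
  isField = record { 1≉0 = nontrivial ; inverse = inverse }
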